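{- (Generalization) Let $m\in\{3,4,5\}$, $\Phi\cup\{\varphi\}\subseteq Fm(C)$ and $x\in fvar(\varphi)\setminus fvar(\Phi)$. If $\Phi\vdash_m\varphi$, then $\Phi\vdash_m\forall x\varphi$.
   Context: Let $V=\{x_0,x_1,x_2,\dots\}$ be a countable, linearly ordered set of propositional variables and $C$ a set of propositional constants with $\top,\bot\in C$. $Fm(C)$ is the set of formulas generated from $V\cup C$ by the unary connectives $\neg,\square$, the binary connectives $\rightarrow,\vee,\wedge,\equiv$ (propositional identity), and the propositional quantifier $\forall$, where $\forall x\varphi$ is a formula only if $x\in V$ occurs free in $\varphi$; $fvar(\varphi)$ is the set of free variables of $\varphi$ and $fvar(\Phi)=\bigcup_{\psi\in\Phi}fvar(\psi)$. A substitution $\sigma\colon V\cup C\to Fm(C)$ extends homomorphically over connectives, and $(\forall x\varphi)[\sigma]=\forall y(\varphi[\sigma[x:=y]])$, where $\sigma[x:=y]$ agrees with $\sigma$ except that it sends $x$ to $y$, and $y$ is the least variable greater than all variables free in some $\sigma(u)$ with $u$ a free variable or constant of $\forall x\varphi$. $\varphi[x:=\psi]$ is the result of the substitution sending $x$ to $\psi$ and fixing all other symbols. $\varphi=_\alpha\psi$ means $\varphi,\psi$ differ at most in bound variables. The axiom set $\mathbb{AX}$ is the smallest set containing all formulas of the following forms and closed under: if $\varphi\in\mathbb{AX}$ and $x\in fvar(\varphi)$ then $\forall x\varphi\in\mathbb{AX}$: (i) substitution instances of classical propositional tautologies; (ii) $\square\varphi\rightarrow\varphi$; (iii) $\square(\varphi\rightarrow\psi)\rightarrow(\square\varphi\rightarrow\square\psi)$;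 (iv) $\square(\varphi\rightarrow\psi)\rightarrow\square(\square\varphi\rightarrow\square\psi)$; (v) $\varphi\equiv\psi$ whenever $\varphi=_\alpha\psi$; (vi) $(\varphi\equiv\psi)\rightarrow(\varphi\rightarrow\psi)$; (vii) $(\psi\equiv\psi')\rightarrow(\varphi[x:=\psi]\equiv\varphi[x:=\psi'])$ if $x\in fvar(\varphi)$; (viii) $\forall x(\varphi\equiv\psi)\rightarrow(\forall x\varphi\equiv\forall x\psi)$; (ix) $\forall x\varphi\rightarrow\varphi[x:=\psi]$; (x) $\forall x(\varphi\rightarrow\psi)\rightarrow(\forall x\varphi\rightarrow\forall x\psi)$; (xi) $\forall x(\varphi\rightarrow\psi)\rightarrow(\varphi\rightarrow\forall x\psi)$ if $x\notin fvar(\varphi)$; (xii) $\square\forall x\varphi\rightarrow\forall x\square\varphi$; (xiii) $\forall x\square\varphi\rightarrow\square\forall x\varphi$ (each whenever well-formed). Rules: Modus Ponens, and Axiom Necessitation (from an axiom $\varphi$ infer $\square\varphi$). A derivation of $\varphi$ from $\Phi$ is a finite sequence ending in $\varphi$ whose members are in $\Phi$, axioms, obtained by Axiom Necessitation, or obtained by Modus Ponens from earlier members. $\Phi\vdash_3\varphi$ means such a derivation exists (system $S3^\forall_\equiv$); $\vdash_4$ is the same with the scheme $\square\varphi\rightarrow\square\square\varphi$ added to the axioms, and $\vdash_5$ additionally adds $\neg\square\varphi\rightarrow\square\neg\square\varphi$. -}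

module Defs where

open import Data.Nat using (ℕ; zero; suc; _⊔_; _≟_; _≡ᵇ_)
open import Data.Bool using (Bool; true; false; if_then_else_; not; _∧_; _∨_)
open import Data.List using (List; []; _∷_; _++_; filter; concatMap; foldr)
open import Data.List.Membership.Propositional using (_∈_; _∉_)
open import Data.Product using (_×_; _,_)
open import Data.Sum using (_⊎_)
import Data.Empty as Empty
import Data.Unit as Unit
open import Relation.Nullary using (¬_; ¬?)
open import Relation.Binary.PropositionalEquality using (_≡_; _≢_)

-- Formulas of Fm(C).  Variables x_i are represented by i : ℕ (ordered as ℕ).
-- The constants are ⊤ (top), ⊥ (bot), and the further constants `con c`, c : C.

data Fm (C : Set) : Set where
  var  : ℕ → Fm C
  con  : C → Fm C
  top  : Fm C
  bot  : Fm C
  neg  : Fm C → Fm C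
  box  : Fm C → Fm C
  imp  : Fm C → Fm C → Fm C
  or   : Fm C → Fm C → Fm C
  and  : Fm C → Fm C → Fm C
  eqv  : Fm C → Fm C → Fm C      -- propositional identity  φ ≡ ψ
  all  : ℕ → Fm C → Fm C

module _ {C : Set} where

  fv : Fm C → List ℕ
  fv (var x)     = x ∷ []
  fv (con c)     = []
  fv top         = []
  fv bot         = []
  fv (neg φ)     = fv φ
  fv (box φ)     = fv φ
  fv (imp φ ψ)   = fv φ ++ fv ψ
  fv (or φ ψ)    = fv φ ++ fv ψ
  fv (and φ ψ)   = fv φ ++ fv ψ
  fv (eqv φ ψ)   = fv φ ++ fv ψ
  fv (all x φ)   = filter (λ y → ¬? (y ≟ x)) (fv φ)

  data WF : Fm C → Set where
    wvar : ∀ {x} → WF (var x)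
    wcon : ∀ {c} → WF (con c)
    wtop : WF top
    wbot : WF bot
    wneg : ∀ {φ} → WF φ → WF (neg φ)
    wbox : ∀ {φ} → WF φ → WF (box φ)
    wimp : ∀ {φ ψ} → WF φ → WF ψ → WF (imp φ ψ)
    wor  : ∀ {φ ψ} → WF φ → WF ψ → WF (or φ ψ)
    wand : ∀ {φ ψ} → WF φ → WF ψ → WF (and φ ψ)
    weqv : ∀ {φ ψ} → WF φ → WF ψ → WF (eqv φ ψ)
    wall : ∀ {x φ} → WF φ → x ∈ fv φ → WF (all x φ)

  sup : List ℕ → ℕ
  sup = foldr (λ n m → suc n ⊔ m) 0

  Subst : Set
  Subst = ℕ → Fm C

  update : Subst → ℕ → Fm C → Subst
  update σ x t u = if u ≡ᵇ x then t else σ u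

  -- capture-avoiding substitution (constants are fixed), with the paper's
  -- renaming convention: (∀xφ)[σ] = ∀y(φ[σ[x:=y]]), y the least variable
  -- greater than all variables free in σ(u), u free in ∀xφ.
  subst : Subst → Fm C → Fm C
  subst σ (var x)   = σ x
  subst σ (con c)   = con c
  subst σ top       = top
  subst σ bot       = bot
  subst σ (neg φ)   = neg (subst σ φ)
  subst σ (box φ)   = box (subst σ φ)
  subst σ (imp φ ψ) = imp (subst σ φ) (subst σ ψ)
  subst σ (or φ ψ)  = or (subst σ φ) (subst σ ψ)
  subst σ (and φ ψ) = and (subst σ φ) (subst σ ψ)
  subst σ (eqv φ ψ) = eqv (subst σ φ) (subst σ ψ)
  subst σ (all x φ) =
    all (sup (concatMap (λ u → fv (σ u)) (fv (all x φ))))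
        (subst (update σ x (var (sup (concatMap (λ u → fv (σ u)) (fv (all x φ)))))) φ)

  _[_:=_] : Fm C → ℕ → Fm C → Fm C
  φ [ x := ψ ] = subst (update var x ψ) φ

  -- α-equivalence (differ at most in bound variables), via a context of
  -- paired bound variables
  VarRel : List (ℕ × ℕ) → ℕ → ℕ → Set
  VarRel []             x y = x ≡ y
  VarRel ((a , b) ∷ Γ)  x y = (x ≡ a × y ≡ b) ⊎ (x ≢ a × y ≢ b × VarRel Γ x y)

  data AlphaCtx : List (ℕ × ℕ) → Fm C → Fm C → Set where
    αvar : ∀ {Γ x y} → VarRel Γ x y → AlphaCtx Γ (var x) (var y)
    αcon : ∀ {Γ c} → AlphaCtx Γ (con c) (con c)
    αtop : ∀ {Γ} → AlphaCtx Γ top top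
    αbot : ∀ {Γ} → AlphaCtx Γ bot bot
    αneg : ∀ {Γ φ φ'} → AlphaCtx Γ φ φ' → AlphaCtx Γ (neg φ) (neg φ')
    αbox : ∀ {Γ φ φ'} → AlphaCtx Γ φ φ' → AlphaCtx Γ (box φ) (box φ')
    αimp : ∀ {Γ φ φ' ψ ψ'} → AlphaCtx Γ φ φ' → AlphaCtx Γ ψ ψ' → AlphaCtx Γ (imp φ ψ) (imp φ' ψ')
    αor  : ∀ {Γ φ φ' ψ ψ'} → AlphaCtx Γ φ φ' → AlphaCtx Γ ψ ψ' → AlphaCtx Γ (or φ ψ) (or φ' ψ')
    αand : ∀ {Γ φ φ' ψ ψ'} → AlphaCtx Γ φ φ' → AlphaCtx Γ ψ ψ' → AlphaCtx Γ (and φ ψ) (and φ' ψ')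
    αeqv : ∀ {Γ φ φ' ψ ψ'} → AlphaCtx Γ φ φ' → AlphaCtx Γ ψ ψ' → AlphaCtx Γ (eqv φ ψ) (eqv φ' ψ')
    αall : ∀ {Γ x y φ ψ} → AlphaCtx ((x , y) ∷ Γ) φ ψ → AlphaCtx Γ (all x φ) (all y ψ)

  _=α_ : Fm C → Fm C → Set
  φ =α ψ = AlphaCtx [] φ ψ

data PFm : Set where
  pvar : ℕ → PFm
  ptop : PFm
  pbot : PFm
  pneg : PFm → PFm
  pimp : PFm → PFm → PFm
  por  : PFm → PFm → PFm
  pand : PFm → PFm → PFm

eval : (ℕ → Bool) → PFm → Bool
eval v (pvar n)   = v n
eval v ptop       = true
eval v pbot       = false
eval v (pneg p)   = not (eval v p)
eval v (pimp p q) = not (eval v p) ∨ eval v q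
eval v (por p q)  = eval v p ∨ eval v q
eval v (pand p q) = eval v p ∧ eval v q

Tautology : PFm → Set
Tautology p = ∀ (v : ℕ → Bool) → eval v p ≡ true

inst : {C : Set} → (ℕ → Fm C) → PFm → Fm C
inst τ (pvar n)   = τ n
inst τ ptop       = top
inst τ pbot       = bot
inst τ (pneg p)   = neg (inst τ p)
inst τ (pimp p q) = imp (inst τ p) (inst τ q)
inst τ (por p q)  = or (inst τ p) (inst τ q)
inst τ (pand p q) = and (inst τ p) (inst τ q)

data System : Set where
  S3 S4 S5 : System

Has4 : System → Set
Has4 S3 = Empty.⊥
Has4 S4 = Unit.⊤
Has4 S5 = Unit.⊤

module _ {C : Set} where

  data Axiom (m : System) : Fm C → Set where
    ax-taut : ∀ {p} (τ : ℕ → Fm C) → Tautology p → WF (inst τ p) → Axiom m (inst τ p)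
    ax-T    : ∀ {φ} → WF φ → Axiom m (imp (box φ) φ)
    ax-K    : ∀ {φ ψ} → WF φ → WF ψ →
              Axiom m (imp (box (imp φ ψ)) (imp (box φ) (box ψ)))
    ax-S3   : ∀ {φ ψ} → WF φ → WF ψ →
              Axiom m (imp (box (imp φ ψ)) (box (imp (box φ) (box ψ))))
    ax-α    : ∀ {φ ψ} → WF φ → WF ψ → φ =α ψ → Axiom m (eqv φ ψ)
    ax-id   : ∀ {φ ψ} → WF φ → WF ψ → Axiom m (imp (eqv φ ψ) (imp φ ψ))
    ax-SI   : ∀ {φ ψ ψ' x} → x ∈ fv φ →
              WF (imp (eqv ψ ψ') (eqv (φ [ x := ψ ]) (φ [ x := ψ' ]))) →
              Axiom m (imp (eqv ψ ψ') (eqv (φ [ x := ψ ]) (φ [ x := ψ' ])))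
    ax-∀≡   : ∀ {x φ ψ} → WF (imp (all x (eqv φ ψ)) (eqv (all x φ) (all x ψ))) →
              Axiom m (imp (all x (eqv φ ψ)) (eqv (all x φ) (all x ψ)))
    ax-inst : ∀ {x φ ψ} → WF (imp (all x φ) (φ [ x := ψ ])) →
              Axiom m (imp (all x φ) (φ [ x := ψ ]))
    ax-∀K   : ∀ {x φ ψ} → WF (imp (all x (imp φ ψ)) (imp (all x φ) (all x ψ))) →
              Axiom m (imp (all x (imp φ ψ)) (imp (all x φ) (all x ψ)))
    ax-∀vac : ∀ {x φ ψ} → x ∉ fv φ → WF (imp (all x (imp φ ψ)) (imp φ (all x ψ))) →
              Axiom m (imp (all x (imp φ ψ)) (imp φ (all x ψ)))
    ax-CBF  : ∀ {x φ} → WF (imp (box (all x φ)) (all x (box φ))) →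
              Axiom m (imp (box (all x φ)) (all x (box φ)))
    ax-BF   : ∀ {x φ} → WF (imp (all x (box φ)) (box (all x φ))) →
              Axiom m (imp (all x (box φ)) (box (all x φ)))
    ax-4    : ∀ {φ} → Has4 m → WF φ → Axiom m (imp (box φ) (box (box φ)))
    ax-5    : ∀ {φ} → m ≡ S5 → WF φ → Axiom m (imp (neg (box φ)) (box (neg (box φ))))
    ax-gen  : ∀ {x φ} → Axiom m φ → x ∈ fv φ → Axiom m (all x φ)

  data Derivable (m : System) (Φ : Fm C → Set) : Fm C → Set where
    hyp : ∀ {φ} → Φ φ → Derivable m Φ φ
    ax  : ∀ {φ} → Axiom m φ → Derivable m Φ φ
    nec : ∀ {φ} → Axiom m φ → Derivable m Φ (box φ)
    mp  : ∀ {φ ψ} → Derivable m Φ (imp φ ψ) → Derivable m Φ φ → Derivable m Φ ψ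

module Submission where

-- A hypothesis cannot be used, since x is not free
-- in Φ; axioms are closed under generalisation by definition; a necessitated
-- axiom □φ yields □∀xφ and then ∀x□φ by the converse Barcan formula.  For modus
-- ponens from ψ → χ and ψ, the distribution axiom ∀x(ψ → χ) → ∀xψ → ∀xχ applies
-- when x is free in ψ; otherwise ψ itself is available and the axiom
-- ∀x(ψ → χ) → ψ → ∀xχ for vacuous x is used.

open import Defs
open import Data.Nat using (ℕ)
open import Data.List.Membership.Propositional using (_∈_; _∉_)
open import Data.List.Membership.Propositional.Properties using (∈-++⁺ʳ)
open import Data.List.Membership.DecPropositional Data.Nat._≟_ using (_∈?_)
open import Relation.Nullary using (yes; no)

module _ {C : Set} {m : System} where

  axiom-wf : {φ : Fm C} → Axiom m φ → WF φ
  axiom-wf (ax-taut τ _ w) = w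
  axiom-wf (ax-T w)        = wimp (wbox w) w
  axiom-wf (ax-K v w)      = wimp (wbox (wimp v w)) (wimp (wbox v) (wbox w))
  axiom-wf (ax-S3 v w)     = wimp (wbox (wimp v w)) (wbox (wimp (wbox v) (wbox w)))
  axiom-wf (ax-α v w _)    = weqv v w
  axiom-wf (ax-id v w)     = wimp (weqv v w) (wimp v w)
  axiom-wf (ax-SI _ w)     = w
  axiom-wf (ax-∀≡ w)       = w
  axiom-wf (ax-inst w)     = w
  axiom-wf (ax-∀K w)       = w
  axiom-wf (ax-∀vac _ w)   = w
  axiom-wf (ax-CBF w)      = w
  axiom-wf (ax-BF w)       = w
  axiom-wf (ax-4 _ w)      = wimp (wbox w) (wbox (wbox w))
  axiom-wf (ax-5 _ w)      = wimp (wneg (wbox w)) (wbox (wneg (wbox w)))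
  axiom-wf (ax-gen a x∈φ)  = wall (axiom-wf a) x∈φ

  module _ {Φ : Fm C → Set} where

    derivable-wf : (∀ ψ → Φ ψ → WF ψ) → {φ : Fm C} → Derivable m Φ φ → WF φ
    derivable-wf wfΦ (hyp h) = wfΦ _ h
    derivable-wf wfΦ (ax a)  = axiom-wf a
    derivable-wf wfΦ (nec a) = wbox (axiom-wf a)
    derivable-wf wfΦ (mp d e) with derivable-wf wfΦ d
    ... | wimp _ wχ = wχ

    box-all⇒all-box : {x : ℕ} {φ : Fm C} → WF φ → x ∈ fv φ →
                      Derivable m Φ (box (all x φ)) → Derivable m Φ (all x (box φ))
    box-all⇒all-box wφ x∈φ = mp (ax (ax-CBF (wimp (wbox (wall wφ x∈φ)) (wall (wbox wφ) x∈φ))))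

    all-mp : {x : ℕ} {ψ χ : Fm C} → WF ψ → WF χ → x ∈ fv ψ → x ∈ fv χ →
             Derivable m Φ (all x (imp ψ χ)) → Derivable m Φ (all x ψ) →
             Derivable m Φ (all x χ)
    all-mp {ψ = ψ} wψ wχ x∈ψ x∈χ d e = mp (mp (ax (ax-∀K wf)) d) e
      where
      wf = wimp (wall (wimp wψ wχ) (∈-++⁺ʳ (fv ψ) x∈χ)) (wimp (wall wψ x∈ψ) (wall wχ x∈χ))

    all-mp-vacuous : {x : ℕ} {ψ χ : Fm C} → WF ψ → WF χ → x ∉ fv ψ → x ∈ fv χ →
                     Derivable m Φ (all x (imp ψ χ)) → Derivable m Φ ψ →
                     Derivable m Φ (all x χ)
    all-mp-vacuous {ψ = ψ} wψ wχ x∉ψ x∈χ d e = mp (mp (ax (ax-∀vac x∉ψ wf)) d) e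
      where
      wf = wimp (wall (wimp wψ wχ) (∈-++⁺ʳ (fv ψ) x∈χ)) (wimp wψ (wall wχ x∈χ))

    generalization : (∀ ψ → Φ ψ → WF ψ) → {x : ℕ} → (∀ ψ → Φ ψ → x ∉ fv ψ) →
                     {φ : Fm C} → Derivable m Φ φ → x ∈ fv φ → Derivable m Φ (all x φ)
    generalization wfΦ x∉Φ (hyp h) x∈φ with x∉Φ _ h x∈φ
    ... | ()
    generalization wfΦ x∉Φ (ax a) x∈φ = ax (ax-gen a x∈φ)
    generalization wfΦ x∉Φ (nec a) x∈φ =
      box-all⇒all-box (axiom-wf a) x∈φ (nec (ax-gen a x∈φ))
    generalization wfΦ {x} x∉Φ (mp {ψ} d e) x∈χ with derivable-wf wfΦ d | x ∈? fv ψ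
    ... | wimp wψ wχ | yes x∈ψ =
      all-mp wψ wχ x∈ψ x∈χ (generalization wfΦ x∉Φ d (∈-++⁺ʳ (fv ψ) x∈χ))
                           (generalization wfΦ x∉Φ e x∈ψ)
    ... | wimp wψ wχ | no x∉ψ =
      all-mp-vacuous wψ wχ x∉ψ x∈χ (generalization wfΦ x∉Φ d (∈-++⁺ʳ (fv ψ) x∈χ)) e

lemma4 : {C : Set} (m : System) (Φ : Fm C → Set) (φ : Fm C) (x : ℕ) →
         (∀ ψ → Φ ψ → WF ψ) → WF φ →
         x ∈ fv φ → (∀ ψ → Φ ψ → x ∉ fv ψ) →
         Derivable m Φ φ → Derivable m Φ (all x φ)
lemma4 m Φ φ x wfΦ _ x∈φ x∉Φ d = generalization wfΦ x∉Φ d x∈φ
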